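{- Let $n\ge0$ and $0\le i<3^n$. If $i=(3^n-1)/2$, then $C_n(i)=3^n$. Otherwise, if $m(i)>\lceil n/2\rceil$, then $i$ lies in the steeple of row $n$ and $C_n(i)=3^{2m(i)-n-1}$.
   Context: The unit weight-$3$ Stern–Brocot sequences $SB_n$ ($n\ge0$): $SB_0=(\frac{0}{1},\frac{1}{1})$, and $SB_{n+1}$ is obtained from $SB_n$ by keeping all its terms in order and inserting, between each pair of consecutive terms $\frac{p}{q},\frac{r}{s}$ (in lowest terms, positive denominators), the two fractions $\frac{2p+r}{2q+s}$ and $\frac{p+2r}{q+2s}$, each reduced to lowest terms, in this order. $SB_n$ has $3^n+1$ terms, indexed from $0$. For $0\le i<3^n$, $C_n(i)=qr-ps$ where $\frac{p}{q}$ and $\frac{r}{s}$ are the $i$-th and $(i+1)$-th terms of $SB_n$ in lowest terms with positive denominators. Middleness: write $i$ in base $3$ with exactly $n$ digits $d_1d_2\cdots d_n$ (leading zeros allowed, $d_1$ most significant); $m(i)$ is the least $t\ge1$ with $d_t\in\{0,2\}$ (undefined when all digits are $1$, i.e. $i=(3^n-1)/2$, the middle index). The steeple of row $n$ is the largest contiguous range of indices containing the middle index $(3^n-1)/2$ on which no value of $C_n$ equals $1$. -}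

module Defs where

open import Data.Nat as ℕ using (ℕ; zero; suc; _∸_; _^_; _≤_; _<_)
open import Data.Nat.DivMod using (_/_; _%_)
open import Data.Nat.Properties using (_≟_; m^n≢0)
open import Data.Integer as ℤ using (ℤ; +_)
open import Data.Rational as ℚ using (ℚ; ↥_; ↧_; ↧ₙ_; 0ℚ)
open import Data.List using (List; []; _∷_; map; upTo)
open import Data.Maybe using (Maybe; just; nothing)
open import Data.Empty using (⊥)
open import Relation.Binary.PropositionalEquality using (_≡_)
open import Relation.Nullary using (¬_; yes; no)

-- weighted mediant ((a+1) p + b r)/((a+1) q + b s), reduced to lowest terms by ℚ._/_
-- (x = p/q and y = r/s in lowest terms with positive denominators)
wmed : ℕ → ℕ → ℚ → ℚ → ℚ
wmed a b x y = ((+ suc a) ℤ.* (↥ x) ℤ.+ (+ b) ℤ.* (↥ y))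
               ℚ./ ((suc a) ℕ.* (↧ₙ x) ℕ.+ b ℕ.* (↧ₙ y))

-- one refinement step: between consecutive x = p/q, y = r/s insert
-- (2p+r)/(2q+s) and (p+2r)/(q+2s), in this order
refine : List ℚ → List ℚ
refine [] = []
refine (x ∷ []) = x ∷ []
refine (x ∷ y ∷ rest) = x ∷ wmed 1 1 x y ∷ wmed 0 2 x y ∷ refine (y ∷ rest)

SB : ℕ → List ℚ
SB zero = ℚ.0ℚ ∷ ℚ.1ℚ ∷ []
SB (suc n) = refine (SB n)

-- i-th term (indexed from 0), with a dummy default out of range
nth : List ℚ → ℕ → ℚ
nth [] _ = ℚ.0ℚ
nth (x ∷ xs) zero = x
nth (x ∷ xs) (suc i) = nth xs i

C : ℕ → ℕ → ℤ
C n i = (↧ x) ℤ.* (↥ y) ℤ.- (↥ x) ℤ.* (↧ y)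
  where
    x = nth (SB n) i
    y = nth (SB n) (suc i)

-- base-3 digits d_1 … d_n of i (exactly n digits, d_1 most significant)
digits : ℕ → ℕ → List ℕ
digits n i = map (λ t → ((_/_ i (3 ^ (n ∸ t))) {{m^n≢0 3 (n ∸ t)}}) % 3) (map suc (upTo n))

-- 1-based position of the first entry different from 1 (i.e. in {0,2})
firstNot1 : List ℕ → Maybe ℕ
firstNot1 [] = nothing
firstNot1 (d ∷ ds) with d ≟ 1
... | no _ = just 1
... | yes _ with firstNot1 ds
...   | just t = just (suc t)
...   | nothing = nothing

-- middleness m(i) (nothing when all digits are 1)
middleness : ℕ → ℕ → Maybe ℕ
middleness n i = firstNot1 (digits n i)

middleIndex : ℕ → ℕ
middleIndex n = (3 ^ n ∸ 1) / 2

-- i lies in the steeple of row n: i is in the largest contiguous range of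
-- indices containing the middle index on which C n never equals 1,
-- i.e. every index j between i and the middle index (inclusive) has C n j ≠ 1
InSteeple : ℕ → ℕ → Set
InSteeple n i = ∀ j → ℕ._⊓_ i (middleIndex n) ≤ j → j ≤ ℕ._⊔_ i (middleIndex n) → ¬ (C n j ≡ ℤ.1ℤ)

{-# OPTIONS --safe #-}
-- Write consecutive terms p/q, r/s as integer vectors x = (p, q), y = (r, s), so that C is
-- det(x, y). The middle pair of row n is (a/3ⁿ, (a+1)/3ⁿ) with 2a + 1 = 3ⁿ, hence C = 3ⁿ
-- there, and its two outer subintervals are side pairs: y = x + 3ᵉ z with det(x, z) = 1.
-- Refining a side pair of exponent e + 1 gives three side pairs of exponent e, because the
-- unreduced mediants 2x + y and x + 2y are 3 times the lattice points x + 3ᵉ z and x + 2·3ᵉ z,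
-- which are primitive since det(·, z) = 1. If i has middleness t, its first t − 1 digits are
-- ones, so its pair lies in an outer subinterval of the middle pair of row t − 1, n − t
-- refinements further down: C = 3^(2t−n−1). Every index between i and the middle index has
-- the same first t − 1 digits, so it is the middle index or has middleness at least t, and
-- for t > ⌈n/2⌉ all these determinants exceed 1.
module Submission where

open import Defs
open import Data.Nat as ℕ using (ℕ; zero; suc; NonZero; _^_)
open import Data.Integer using (ℤ; +_; 1ℤ)
import Data.Integer.Properties as ℤ
open import Data.Rational as ℚ using (ℚ; ↥_; ↧_; ↧ₙ_)
open import Data.Product using (_×_; _,_; proj₁; proj₂; ∃₂; uncurry)
open import Relation.Binary.PropositionalEquality

-- Integer arithmetic is opened only inside this module, so that _+_ and _*_ denote the
-- operations on ℕ in the rest of the file.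
module _ where
  open import Data.Nat.Divisibility using (_∣_; divides; ∣-antisym)
  open import Data.Nat.GCD using (gcd; gcd-greatest)
  import Data.Nat.Properties as ℕ
  open import Data.Integer using (∣_∣; _+_; _*_; _-_; -_)
  open import Data.Integer.Tactic.RingSolver using (solve-∀)
  open import Data.Rational.Properties using (↥-/; ↧-/)
  open import Data.Empty using (⊥-elim)

  ↥↧-/-primitive : ∀ (i : ℤ) n .{{_ : NonZero n}} g .{{_ : NonZero g}} (a b z₁ z₂ : ℤ) →
    i ≡ + g * a → + n ≡ + g * b → b * z₁ - a * z₂ ≡ 1ℤ →
    ↥ (i ℚ./ n) ≡ a × ↧ (i ℚ./ n) ≡ b
  ↥↧-/-primitive i n g a b z₁ z₂ i≡ n≡ bézout = cancel (trans (↥-/ i n) i≡) , cancel (trans (↧-/ i n) n≡)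
    where
    G = gcd ∣ i ∣ n
    U = ↥ (i ℚ./ n)
    D = ↧ (i ℚ./ n)

    ∣-of-multiple : ∀ {c h k} → c ≡ + h * k → h ∣ ∣ c ∣
    ∣-of-multiple {h = h} {k} refl = divides ∣ k ∣ (trans (ℤ.abs-* (+ h) k) (ℕ.*-comm h ∣ k ∣))

    g∣G : g ∣ G
    g∣G = gcd-greatest (∣-of-multiple i≡) (∣-of-multiple n≡)

    g≡G*k : + g ≡ + G * (D * z₁ - U * z₂)
    g≡G*k = begin
      + g                              ≡⟨ ℤ.*-identityʳ (+ g) ⟨
      + g * 1ℤ                         ≡⟨ cong (+ g *_) bézout ⟨
      + g * (b * z₁ - a * z₂)          ≡⟨ scale (+ g) b a z₁ z₂ ⟩
      + g * b * z₁ - + g * a * z₂      ≡⟨ cong₂ (λ u v → u * z₁ - v * z₂) n≡ i≡ ⟨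
      + n * z₁ - i * z₂                ≡⟨ cong₂ (λ u v → u * z₁ - v * z₂) (↧-/ i n) (↥-/ i n) ⟨
      D * + G * z₁ - U * + G * z₂      ≡⟨ unscale D U (+ G) z₁ z₂ ⟩
      + G * (D * z₁ - U * z₂)          ∎
      where
      open ≡-Reasoning
      scale : ∀ h b a z₁ z₂ → h * (b * z₁ - a * z₂) ≡ h * b * z₁ - h * a * z₂
      scale = solve-∀
      unscale : ∀ D U G z₁ z₂ → D * G * z₁ - U * G * z₂ ≡ G * (D * z₁ - U * z₂)
      unscale = solve-∀

    G≡g : G ≡ g
    G≡g = ∣-antisym (∣-of-multiple g≡G*k) g∣G

    cancel : ∀ {X Y} → X * + G ≡ + g * Y → X ≡ Y
    cancel {X} {Y} eq = ℤ.*-cancelʳ-≡ X Y (+ g)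
      (trans (cong (λ h → X * + h) (sym G≡g)) (trans eq (ℤ.*-comm (+ g) Y)))

  wmed-primitive : ∀ α β x y g .{{_ : NonZero g}} (p q z₁ z₂ : ℤ) →
    + suc α * ↥ x + + β * ↥ y ≡ + g * p →
    + suc α * ↧ x + + β * ↧ y ≡ + g * q →
    q * z₁ - p * z₂ ≡ 1ℤ →
    ↥ (wmed α β x y) ≡ p × ↧ (wmed α β x y) ≡ q
  wmed-primitive α β x y g p q z₁ z₂ num den =
    ↥↧-/-primitive _ _ g p q z₁ z₂ num (trans denominator den)
    where
    denominator : + (suc α ℕ.* ↧ₙ x ℕ.+ β ℕ.* ↧ₙ y) ≡ + suc α * ↧ x + + β * ↧ y
    denominator = trans (ℤ.pos-+ (suc α ℕ.* ↧ₙ x) _) (cong₂ _+_ (ℤ.pos-* (suc α) _) (ℤ.pos-* β _))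

  cross : ℚ × ℚ → ℤ
  cross (x , y) = ↧ x * ↥ y - ↥ x * ↧ y

  subpair : ℕ → ℚ × ℚ → ℚ × ℚ
  subpair 0 (x , y) = x , wmed 1 1 x y
  subpair 1 (x , y) = wmed 1 1 x y , wmed 0 2 x y
  subpair _ (x , y) = wmed 0 2 x y , y

  record Side (e : ℕ) (x y : ℚ) : Set where
    field
      z₁ z₂ : ℤ
      ↥-step : ↥ y ≡ ↥ x + + (3 ^ e) * z₁
      ↧-step : ↧ y ≡ ↧ x + + (3 ^ e) * z₂
      unimodular : ↧ x * z₁ - ↥ x * z₂ ≡ 1ℤ

  record Middle (n : ℕ) (x y : ℚ) : Set where
    field
      ↧x≡3^n : ↧ x ≡ + (3 ^ n)
      ↧x≡2↥x+1 : ↧ x ≡ + 2 * ↥ x + 1ℤ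
      ↥y≡↥x+1 : ↥ y ≡ ↥ x + 1ℤ
      ↧y≡↧x : ↧ y ≡ ↧ x

  private
    det-shift : ∀ a b c z₁ z₂ → (b + c * z₂) * z₁ - (a + c * z₁) * z₂ ≡ b * z₁ - a * z₂
    det-shift = solve-∀

  cross-side : ∀ {e x y} → Side e x y → cross (x , y) ≡ + (3 ^ e)
  cross-side {e} {x} {y} S = begin
    ↧ x * ↥ y - ↥ x * ↧ y                                  ≡⟨ cong₂ (λ u v → ↧ x * u - ↥ x * v) ↥-step ↧-step ⟩
    ↧ x * (↥ x + P * z₁) - ↥ x * (↧ x + P * z₂)            ≡⟨ factor (↥ x) (↧ x) P z₁ z₂ ⟩
    P * (↧ x * z₁ - ↥ x * z₂)                              ≡⟨ cong (P *_) unimodular ⟩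
    P * 1ℤ                                                 ≡⟨ ℤ.*-identityʳ P ⟩
    P                                                      ∎
    where
    open Side S
    open ≡-Reasoning
    P = + (3 ^ e)
    factor : ∀ a b P z₁ z₂ → b * (a + P * z₁) - a * (b + P * z₂) ≡ P * (b * z₁ - a * z₂)
    factor = solve-∀

  cross-middle : ∀ {n x y} → Middle n x y → cross (x , y) ≡ + (3 ^ n)
  cross-middle {n} {x} {y} M = begin
    ↧ x * ↥ y - ↥ x * ↧ y          ≡⟨ cong₂ (λ u v → ↧ x * u - ↥ x * v) ↥y≡↥x+1 ↧y≡↧x ⟩
    ↧ x * (↥ x + 1ℤ) - ↥ x * ↧ x   ≡⟨ cancel (↥ x) (↧ x) ⟩
    ↧ x                            ≡⟨ ↧x≡3^n ⟩
    + (3 ^ n)                      ∎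
    where
    open Middle M
    open ≡-Reasoning
    cancel : ∀ a b → b * (a + 1ℤ) - a * b ≡ b
    cancel = solve-∀

  module _ {e : ℕ} {x y : ℚ} (S : Side (suc e) x y) where
    open Side S

    private
      P : ℤ
      P = + (3 ^ e)

      OnLine : ℤ → ℚ → Set
      OnLine k w = ↥ w ≡ ↥ x + k * P * z₁ × ↧ w ≡ ↧ x + k * P * z₂

      side-between : ∀ k {u v} → OnLine k u → OnLine (k + 1ℤ) v → Side e u v
      side-between k (u↥ , u↧) (v↥ , v↧) = record
        { z₁ = z₁
        ; z₂ = z₂
        ; ↥-step = trans v↥ (trans (step (↥ x) k P z₁) (cong (_+ P * z₁) (sym u↥)))
        ; ↧-step = trans v↧ (trans (step (↧ x) k P z₂) (cong (_+ P * z₂) (sym u↧)))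
        ; unimodular = trans (cong₂ (λ b a → b * z₁ - a * z₂) u↧ u↥)
                             (trans (det-shift (↥ x) (↧ x) (k * P) z₁ z₂) unimodular)
        }
        where
        step : ∀ a k P z → a + (k + 1ℤ) * P * z ≡ a + k * P * z + P * z
        step = solve-∀

      x-on-line : OnLine (+ 0) x
      x-on-line = start (↥ x) P z₁ , start (↧ x) P z₂
        where
        start : ∀ a P z → a ≡ a + + 0 * P * z
        start = solve-∀

      y-on-line : OnLine (+ 3) y
      y-on-line = trans ↥-step (cong (λ c → ↥ x + c * z₁) (ℤ.pos-* 3 (3 ^ e)))
                , trans ↧-step (cong (λ c → ↧ x + c * z₂) (ℤ.pos-* 3 (3 ^ e)))

      wmed-on-line : ∀ α β → + suc α + + β ≡ + 3 → OnLine (+ β) (wmed α β x y)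
      wmed-on-line α β weights = wmed-primitive α β x y 3 _ _ z₁ z₂
        (trans (cong (λ v → + suc α * ↥ x + + β * v) (proj₁ y-on-line)) (thirds (↥ x) z₁))
        (trans (cong (λ v → + suc α * ↧ x + + β * v) (proj₂ y-on-line)) (thirds (↧ x) z₂))
        (trans (det-shift (↥ x) (↧ x) (+ β * P) z₁ z₂) unimodular)
        where
        expand : ∀ A B a P z → A * a + B * (a + + 3 * P * z) ≡ (A + B) * a + + 3 * (B * P * z)
        expand = solve-∀
        thirds : ∀ a z → + suc α * a + + β * (a + + 3 * P * z) ≡ + 3 * (a + + β * P * z)
        thirds a z = trans (expand (+ suc α) (+ β) a P z)
          (trans (cong (λ s → s * a + + 3 * (+ β * P * z)) weights)
                 (sym (ℤ.*-distribˡ-+ (+ 3) a (+ β * P * z))))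

    side-subpair : ∀ d → uncurry (Side e) (subpair d (x , y))
    side-subpair 0             = side-between (+ 0) x-on-line (wmed-on-line 1 1 refl)
    side-subpair 1             = side-between (+ 1) (wmed-on-line 1 1 refl) (wmed-on-line 0 2 refl)
    side-subpair (suc (suc _)) = side-between (+ 2) (wmed-on-line 0 2 refl) y-on-line

  module _ {n : ℕ} {x y : ℚ} (M : Middle n x y) where
    open Middle M

    private
      a N : ℤ
      a = ↥ x
      N = ↧ x

      -- each identity below is polynomial in a once N is replaced by 2a + 1
      odd : ∀ (P : ℤ → Set) → P (+ 2 * a + 1ℤ) → P N
      odd P = subst P (sym ↧x≡2↥x+1)

      left-bézout : + 3 * N * 1ℤ - (+ 3 * a + 1ℤ) * + 2 ≡ 1ℤ
      left-bézout = odd (λ N → + 3 * N * 1ℤ - (+ 3 * a + 1ℤ) * + 2 ≡ 1ℤ) (bézout a)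
        where
        bézout : ∀ a → + 3 * (+ 2 * a + 1ℤ) * 1ℤ - (+ 3 * a + 1ℤ) * + 2 ≡ 1ℤ
        bézout = solve-∀

      right-bézout : + 3 * N * - 1ℤ - (+ 3 * a + + 2) * - + 2 ≡ 1ℤ
      right-bézout = odd (λ N → + 3 * N * - 1ℤ - (+ 3 * a + + 2) * - + 2 ≡ 1ℤ) (bézout a)
        where
        bézout : ∀ a → + 3 * (+ 2 * a + 1ℤ) * - 1ℤ - (+ 3 * a + + 2) * - + 2 ≡ 1ℤ
        bézout = solve-∀

      left : ↥ (wmed 1 1 x y) ≡ + 3 * a + 1ℤ × ↧ (wmed 1 1 x y) ≡ + 3 * N
      left = wmed-primitive 1 1 x y 1 _ _ 1ℤ (+ 2)
        (trans (cong (λ v → + 2 * a + + 1 * v) ↥y≡↥x+1) (numerator a))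
        (trans (cong (λ v → + 2 * N + + 1 * v) ↧y≡↧x) (denominator N))
        left-bézout
        where
        numerator : ∀ a → + 2 * a + + 1 * (a + 1ℤ) ≡ + 1 * (+ 3 * a + 1ℤ)
        numerator = solve-∀
        denominator : ∀ N → + 2 * N + + 1 * N ≡ + 1 * (+ 3 * N)
        denominator = solve-∀

      right : ↥ (wmed 0 2 x y) ≡ + 3 * a + + 2 × ↧ (wmed 0 2 x y) ≡ + 3 * N
      right = wmed-primitive 0 2 x y 1 _ _ (- 1ℤ) (- + 2)
        (trans (cong (λ v → + 1 * a + + 2 * v) ↥y≡↥x+1) (numerator a))
        (trans (cong (λ v → + 1 * N + + 2 * v) ↧y≡↧x) (denominator N))
        right-bézout
        where
        numerator : ∀ a → + 1 * a + + 2 * (a + 1ℤ) ≡ + 1 * (+ 3 * a + + 2)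
        numerator = solve-∀
        denominator : ∀ N → + 1 * N + + 2 * N ≡ + 1 * (+ 3 * N)
        denominator = solve-∀

      side : ∀ {u v} z₁ z₂ → ↥ v ≡ ↥ u + N * z₁ → ↧ v ≡ ↧ u + N * z₂ →
             ↧ u * z₁ - ↥ u * z₂ ≡ 1ℤ → Side n u v
      side {u} {v} z₁ z₂ ↥v ↧v uni = record
        { z₁ = z₁
        ; z₂ = z₂
        ; ↥-step = subst (λ P → ↥ v ≡ ↥ u + P * z₁) ↧x≡3^n ↥v
        ; ↧-step = subst (λ P → ↧ v ≡ ↧ u + P * z₂) ↧x≡3^n ↧v
        ; unimodular = uni
        }

    middle-subpair-middle : uncurry (Middle (suc n)) (subpair 1 (x , y))
    middle-subpair-middle = record
      { ↧x≡3^n   = trans (proj₂ left) (trans (cong (+ 3 *_) ↧x≡3^n) (sym (ℤ.pos-* 3 (3 ^ n))))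
      ; ↧x≡2↥x+1 = trans (proj₂ left) (trans (odd (λ N → + 3 * N ≡ + 2 * (+ 3 * a + 1ℤ) + 1ℤ) (triple a))
                                             (cong (λ v → + 2 * v + 1ℤ) (sym (proj₁ left))))
      ; ↥y≡↥x+1  = trans (proj₁ right) (trans (succ a) (cong (_+ 1ℤ) (sym (proj₁ left))))
      ; ↧y≡↧x    = trans (proj₂ right) (sym (proj₂ left))
      }
      where
      triple : ∀ a → + 3 * (+ 2 * a + 1ℤ) ≡ + 2 * (+ 3 * a + 1ℤ) + 1ℤ
      triple = solve-∀
      succ : ∀ a → + 3 * a + + 2 ≡ + 3 * a + 1ℤ + 1ℤ
      succ = solve-∀

    middle-subpair-side : ∀ d → d ≢ 1 → uncurry (Side n) (subpair d (x , y))
    middle-subpair-side 0 _ = side 1ℤ (+ 2)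
      (trans (proj₁ left) (odd (λ N → + 3 * a + 1ℤ ≡ a + N * 1ℤ) (numerator a)))
      (trans (proj₂ left) (denominator N))
      (odd (λ N → N * 1ℤ - a * + 2 ≡ 1ℤ) (bézout a))
      where
      numerator : ∀ a → + 3 * a + 1ℤ ≡ a + (+ 2 * a + 1ℤ) * 1ℤ
      numerator = solve-∀
      denominator : ∀ N → + 3 * N ≡ N + N * + 2
      denominator = solve-∀
      bézout : ∀ a → (+ 2 * a + 1ℤ) * 1ℤ - a * + 2 ≡ 1ℤ
      bézout = solve-∀
    middle-subpair-side 1 1≢1 = ⊥-elim (1≢1 refl)
    middle-subpair-side (suc (suc _)) _ = side (- 1ℤ) (- + 2)
      (trans ↥y≡↥x+1 (trans (odd (λ N → a + 1ℤ ≡ + 3 * a + + 2 + N * - 1ℤ) (numerator a))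
                            (cong (_+ N * - 1ℤ) (sym (proj₁ right)))))
      (trans ↧y≡↧x (trans (denominator N) (cong (_+ N * - + 2) (sym (proj₂ right)))))
      (trans (cong₂ (λ b a → b * - 1ℤ - a * - + 2) (proj₂ right) (proj₁ right)) right-bézout)
      where
      numerator : ∀ a → a + 1ℤ ≡ + 3 * a + + 2 + (+ 2 * a + 1ℤ) * - 1ℤ
      numerator = solve-∀
      denominator : ∀ N → N ≡ + 3 * N + N * - + 2
      denominator = solve-∀

open import Data.Nat using (_+_; _*_; _∸_; _<_; _≤_; s≤s; z≤n; ⌈_/2⌉; ⌊_/2⌋; _⊓_; _⊔_)
open import Data.Nat.Properties
open import Data.Nat.DivMod using (_/_; _%_; m≡m%n+[m/n]*n; m%n<n; m<n*o⇒m/o<n; m/n/o≡m/[n*o]; n/1≡n; /-monoˡ-≤; +-distrib-/; m*n/n≡m; [m+kn]%n≡m%n; m*n%n≡0)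
open import Data.Nat.Tactic.RingSolver using (solve-∀)
open import Data.List using (List; []; _∷_; _∷ʳ_; length; applyUpTo; map)
open import Data.List.Properties using (applyUpTo-∷ʳ; map-upTo; map-applyUpTo; length-applyUpTo)
open import Data.Maybe using (Maybe; just; nothing)
open import Data.Maybe.Properties using (just-injective)
open import Data.Sum using (_⊎_; inj₁; inj₂)
open import Function using (_∘_)
open import Relation.Nullary using (¬_; yes; no; contradiction)

-- Rows

refine-head : ∀ x xs → nth (refine (x ∷ xs)) 0 ≡ x
refine-head x []      = refl
refine-head x (_ ∷ _) = refl

length-refine : ∀ x xs → length (refine (x ∷ xs)) ≡ suc (length xs * 3)
length-refine x []       = refl
length-refine x (y ∷ ys) = cong (λ l → 3 + l) (length-refine y ys)

length-SB : ∀ n → length (SB n) ≡ suc (3 ^ n)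
length-SB zero = refl
length-SB (suc n) with SB n | length-SB n
... | x ∷ xs | eq = trans (length-refine x xs) (cong suc (trans (cong (_* 3) (suc-injective eq)) (*-comm (3 ^ n) 3)))

consecutive : List ℚ → ℕ → ℚ × ℚ
consecutive xs i = nth xs i , nth xs (suc i)

consecutive-refine : ∀ xs k d → d < 3 → suc k < length xs →
  consecutive (refine xs) (k * 3 + d) ≡ subpair d (consecutive xs k)
consecutive-refine (x ∷ y ∷ ys) zero    0 _ _ = refl
consecutive-refine (x ∷ y ∷ ys) zero    1 _ _ = refl
consecutive-refine (x ∷ y ∷ ys) zero    2 _ _ = cong (wmed 0 2 x y ,_) (refine-head y ys)
consecutive-refine (x ∷ y ∷ ys) (suc k) d d<3 (s≤s k<) = consecutive-refine (y ∷ ys) k d d<3 k<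
consecutive-refine (x ∷ y ∷ ys) zero (suc (suc (suc _))) (s≤s (s≤s (s≤s ()))) _
consecutive-refine (x ∷ []) k d _ (s≤s ())
consecutive-refine [] k d _ ()

-- C n i is cross (pair n i) by definition.
pair : ℕ → ℕ → ℚ × ℚ
pair n = consecutive (SB n)

/3<3^ : ∀ n {i} → i < 3 ^ suc n → i / 3 < 3 ^ n
/3<3^ n {i} i< = m<n*o⇒m/o<n (subst (i <_) (*-comm 3 (3 ^ n)) i<)

pair-suc : ∀ n i → i < 3 ^ suc n → pair (suc n) i ≡ subpair (i % 3) (pair n (i / 3))
pair-suc n i i< = begin
  pair (suc n) i                                   ≡⟨ cong (pair (suc n)) i≡ ⟩
  consecutive (refine (SB n)) (i / 3 * 3 + i % 3)  ≡⟨ consecutive-refine (SB n) (i / 3) (i % 3) (m%n<n i 3) bound ⟩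
  subpair (i % 3) (pair n (i / 3))                 ∎
  where
  open ≡-Reasoning
  i≡ : i ≡ i / 3 * 3 + i % 3
  i≡ = trans (m≡m%n+[m/n]*n i 3) (+-comm (i % 3) _)
  bound : suc (i / 3) < length (SB n)
  bound = subst (suc (i / 3) <_) (sym (length-SB n)) (s≤s (/3<3^ n i<))

-- The middle index

middleIndex-of : ∀ n {k} → 3 ^ n ≡ suc (k * 2) → middleIndex n ≡ k
middleIndex-of n {k} eq = trans (cong (λ m → (m ∸ 1) / 2) eq) (m*n/n≡m k 2)

3^≡1+2*middleIndex : ∀ n → 3 ^ n ≡ suc (middleIndex n * 2)
middleIndex-suc : ∀ n → middleIndex (suc n) ≡ middleIndex n * 3 + 1

3^suc≡ : ∀ n → 3 ^ suc n ≡ suc ((middleIndex n * 3 + 1) * 2)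
3^suc≡ n = trans (cong (3 *_) (3^≡1+2*middleIndex n)) (triple (middleIndex n))
  where
  triple : ∀ m → 3 * suc (m * 2) ≡ suc ((m * 3 + 1) * 2)
  triple = solve-∀

3^≡1+2*middleIndex zero    = refl
3^≡1+2*middleIndex (suc n) = trans (3^suc≡ n) (cong (λ k → suc (k * 2)) (sym (middleIndex-suc n)))

middleIndex-suc n = middleIndex-of (suc n) (3^suc≡ n)

middleIndex<3^ : ∀ n → middleIndex n < 3 ^ n
middleIndex<3^ n = subst (middleIndex n <_) (sym (3^≡1+2*middleIndex n)) (s≤s (m≤m*n (middleIndex n) 2))

middleIndex-suc-/3 : ∀ n → middleIndex (suc n) / 3 ≡ middleIndex n
middleIndex-suc-/3 n = begin
  middleIndex (suc n) / 3     ≡⟨ cong (_/ 3) (middleIndex-suc n) ⟩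
  (m * 3 + 1) / 3             ≡⟨ +-distrib-/ (m * 3) 1 (subst (λ r → r + 1 < 3) (sym (m*n%n≡0 m 3)) (s≤s (s≤s z≤n))) ⟩
  m * 3 / 3 + 0               ≡⟨ +-identityʳ _ ⟩
  m * 3 / 3                   ≡⟨ m*n/n≡m m 3 ⟩
  m                           ∎
  where
  open ≡-Reasoning
  m = middleIndex n

middleIndex-suc-%3 : ∀ n → middleIndex (suc n) % 3 ≡ 1
middleIndex-suc-%3 n = begin
  middleIndex (suc n) % 3     ≡⟨ cong (_% 3) (trans (middleIndex-suc n) (+-comm _ 1)) ⟩
  (1 + middleIndex n * 3) % 3 ≡⟨ [m+kn]%n≡m%n 1 (middleIndex n) 3 ⟩
  1                           ∎
  where open ≡-Reasoning

-- Middleness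

_/3^_ : ℕ → ℕ → ℕ
j /3^ k = (j / 3 ^ k) {{m^n≢0 3 k}}

-- digit n j t is the digit d_(t+1) of the n-digit base-3 expansion of j.
digit : ℕ → ℕ → ℕ → ℕ
digit n j t = (j /3^ (n ∸ suc t)) % 3

digits≡applyUpTo : ∀ n j → digits n j ≡ applyUpTo (digit n j) n
digits≡applyUpTo n j = trans (cong (map _) (map-upTo suc n)) (map-applyUpTo suc _ n)

applyUpTo-cong : ∀ {A : Set} {f g : ℕ → A} n → (∀ {t} → t < n → f t ≡ g t) → applyUpTo f n ≡ applyUpTo g n
applyUpTo-cong zero    _   = refl
applyUpTo-cong (suc n) f≡g = cong₂ _∷_ (f≡g (s≤s z≤n)) (applyUpTo-cong n (f≡g ∘ s≤s))

digits-∷ʳ : ∀ n j → digits (suc n) j ≡ digits n (j / 3) ∷ʳ j % 3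
digits-∷ʳ n j = begin
  digits (suc n) j                                     ≡⟨ digits≡applyUpTo (suc n) j ⟩
  applyUpTo (digit (suc n) j) (suc n)                  ≡⟨ applyUpTo-∷ʳ (digit (suc n) j) n ⟨
  applyUpTo (digit (suc n) j) n ∷ʳ digit (suc n) j n   ≡⟨ cong₂ _∷ʳ_ (applyUpTo-cong n shift) last ⟩
  applyUpTo (digit n (j / 3)) n ∷ʳ j % 3               ≡⟨ cong (_∷ʳ j % 3) (digits≡applyUpTo n (j / 3)) ⟨
  digits n (j / 3) ∷ʳ j % 3                            ∎
  where
  open ≡-Reasoning
  /3^-suc : ∀ k → j /3^ suc k ≡ (j / 3) /3^ k
  /3^-suc k = sym (m/n/o≡m/[n*o] j 3 (3 ^ k) {{_}} {{m^n≢0 3 k}} {{m^n≢0 3 (suc k)}})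
  shift : ∀ {t} → t < n → digit (suc n) j t ≡ digit n (j / 3) t
  shift {t} t<n = trans (cong (λ k → (j /3^ k) % 3) (+-∸-assoc 1 t<n)) (cong (_% 3) (/3^-suc (n ∸ suc t)))
  last : digit (suc n) j n ≡ j % 3
  last = trans (cong (λ k → (j /3^ k) % 3) (n∸n≡0 n)) (cong (_% 3) (n/1≡n j))

length-digits : ∀ n j → length (digits n j) ≡ n
length-digits n j = trans (cong length (digits≡applyUpTo n j)) (length-applyUpTo _ n)

snocMiddleness : ℕ → Maybe ℕ → ℕ → Maybe ℕ
snocMiddleness n (just t) d = just t
snocMiddleness n nothing  d with d ≟ 1
... | yes _ = nothing
... | no _  = just (suc n)

firstNot1-∷ʳ : ∀ ds d → firstNot1 (ds ∷ʳ d) ≡ snocMiddleness (length ds) (firstNot1 ds) d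
firstNot1-∷ʳ [] d with d ≟ 1
... | yes _ = refl
... | no _  = refl
firstNot1-∷ʳ (e ∷ ds) d with e ≟ 1
... | no _  = refl
... | yes _ with firstNot1 (ds ∷ʳ d) | firstNot1 ds | firstNot1-∷ʳ ds d
...   | _ | just t  | refl = refl
...   | _ | nothing | refl with d ≟ 1
...     | yes _ = refl
...     | no _  = refl

middleness-suc : ∀ n j → middleness (suc n) j ≡ snocMiddleness n (middleness n (j / 3)) (j % 3)
middleness-suc n j = begin
  firstNot1 (digits (suc n) j)                                            ≡⟨ cong firstNot1 (digits-∷ʳ n j) ⟩
  firstNot1 (digits n (j / 3) ∷ʳ j % 3)                                   ≡⟨ firstNot1-∷ʳ (digits n (j / 3)) (j % 3) ⟩
  snocMiddleness (length (digits n (j / 3))) (middleness n (j / 3)) (j % 3) ≡⟨ cong (λ l → snocMiddleness l (middleness n (j / 3)) (j % 3)) (length-digits n (j / 3)) ⟩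
  snocMiddleness n (middleness n (j / 3)) (j % 3)                         ∎
  where open ≡-Reasoning

snocMiddleness-just : ∀ n m d {t} → snocMiddleness n m d ≡ just t →
  m ≡ just t ⊎ (m ≡ nothing × d ≢ 1 × t ≡ suc n)
snocMiddleness-just n (just _) d refl = inj₁ refl
snocMiddleness-just n nothing  d eq with d ≟ 1
snocMiddleness-just n nothing  d () | yes _
... | no d≢1 = inj₂ (refl , d≢1 , sym (just-injective eq))

snocMiddleness-nothing : ∀ n m d → snocMiddleness n m d ≡ nothing → m ≡ nothing × d ≡ 1
snocMiddleness-nothing n (just _) d ()
snocMiddleness-nothing n nothing  d eq with d ≟ 1
... | yes d≡1 = refl , d≡1
snocMiddleness-nothing n nothing  d () | no _

middleness-suc-just : ∀ n j {t} → middleness (suc n) j ≡ just t →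
  middleness n (j / 3) ≡ just t ⊎ (middleness n (j / 3) ≡ nothing × j % 3 ≢ 1 × t ≡ suc n)
middleness-suc-just n j eq = snocMiddleness-just n _ (j % 3) (trans (sym (middleness-suc n j)) eq)

middleness-nothing : ∀ n j → j < 3 ^ n → middleness n j ≡ nothing → j ≡ middleIndex n
middleness-nothing zero    zero    _         _  = refl
middleness-nothing zero    (suc j) (s≤s ())  _
middleness-nothing (suc n) j       j<        eq with snocMiddleness-nothing n _ (j % 3) (trans (sym (middleness-suc n j)) eq)
... | parent , last≡1 = begin
  j                         ≡⟨ trans (m≡m%n+[m/n]*n j 3) (+-comm (j % 3) _) ⟩
  j / 3 * 3 + j % 3         ≡⟨ cong₂ (λ k d → k * 3 + d) (middleness-nothing n (j / 3) (/3<3^ n j<) parent) last≡1 ⟩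
  middleIndex n * 3 + 1     ≡⟨ middleIndex-suc n ⟨
  middleIndex (suc n)       ∎
  where open ≡-Reasoning

middleness-middleIndex : ∀ n → middleness n (middleIndex n) ≡ nothing
middleness-middleIndex zero    = refl
middleness-middleIndex (suc n) = begin
  middleness (suc n) (middleIndex (suc n))                ≡⟨ middleness-suc n (middleIndex (suc n)) ⟩
  snocMiddleness n (middleness n (middleIndex (suc n) / 3)) (middleIndex (suc n) % 3)
    ≡⟨ cong₂ (snocMiddleness n) (trans (cong (middleness n) (middleIndex-suc-/3 n)) (middleness-middleIndex n)) (middleIndex-suc-%3 n) ⟩
  snocMiddleness n nothing 1                               ≡⟨⟩
  nothing                                                  ∎
  where open ≡-Reasoning

prefix : ℕ → ℕ → ℕ
prefix zero    j = j
prefix (suc r) j = prefix r (j / 3)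

prefix-mono-≤ : ∀ r {i j} → i ≤ j → prefix r i ≤ prefix r j
prefix-mono-≤ zero    i≤j = i≤j
prefix-mono-≤ (suc r) i≤j = prefix-mono-≤ r (/-monoˡ-≤ 3 i≤j)

prefix-middleIndex : ∀ r s → prefix r (middleIndex (r + s)) ≡ middleIndex s
prefix-middleIndex zero    s = refl
prefix-middleIndex (suc r) s = trans (cong (prefix r) (middleIndex-suc-/3 (r + s))) (prefix-middleIndex r s)

prefix-between : ∀ r {i k j c} → prefix r i ≡ c → prefix r k ≡ c → i ⊓ k ≤ j → j ≤ i ⊔ k → prefix r j ≡ c
prefix-between r {i} {k} {j} {c} pi pk lo hi = ≤-antisym
  (subst (prefix r j ≤_) (either (⊔-sel i k)) (prefix-mono-≤ r hi))
  (subst (_≤ prefix r j) (either (⊓-sel i k)) (prefix-mono-≤ r lo))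
  where
  either : ∀ {x} → x ≡ i ⊎ x ≡ k → prefix r x ≡ c
  either (inj₁ refl) = pi
  either (inj₂ refl) = pk

middleness-just⇒prefix : ∀ n i {t} → i < 3 ^ n → middleness n i ≡ just t →
  ∃₂ λ r s → n ≡ suc r + s × t ≡ suc s × prefix (suc r) i ≡ middleIndex s
middleness-just⇒prefix zero    i i< ()
middleness-just⇒prefix (suc n) i i< eq with middleness-suc-just n i eq
... | inj₁ parent with middleness-just⇒prefix n (i / 3) (/3<3^ n i<) parent
...   | r , s , n≡ , t≡ , prefix≡ = suc r , s , cong suc n≡ , t≡ , prefix≡
middleness-just⇒prefix (suc n) i i< eq | inj₂ (parent , _ , t≡) =
  0 , n , refl , t≡ , middleness-nothing n (i / 3) (/3<3^ n i<) parent

prefix⇒middleness> : ∀ r s j {t} → prefix r j ≡ middleIndex s → middleness (r + s) j ≡ just t → s < t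
prefix⇒middleness> zero    s j refl eq = contradiction (trans (sym (middleness-middleIndex s)) eq) λ ()
prefix⇒middleness> (suc r) s j prefix≡ eq with middleness-suc-just (r + s) j eq
... | inj₁ parent          = prefix⇒middleness> r s (j / 3) prefix≡ parent
... | inj₂ (_ , _ , refl)  = s≤s (m≤n+m s r)

-- Cross determinants along the rows

middle-pair : ∀ n → uncurry (Middle n) (pair n (middleIndex n))
middle-pair zero    = record { ↧x≡3^n = refl ; ↧x≡2↥x+1 = refl ; ↥y≡↥x+1 = refl ; ↧y≡↧x = refl }
middle-pair (suc n) = subst (uncurry (Middle (suc n))) (sym parent) (middle-subpair-middle (middle-pair n))
  where
  parent : pair (suc n) (middleIndex (suc n)) ≡ subpair 1 (pair n (middleIndex n))
  parent = trans (pair-suc n _ (middleIndex<3^ (suc n)))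
                 (cong₂ subpair (middleIndex-suc-%3 n) (cong (pair n) (middleIndex-suc-/3 n)))

side-pair : ∀ n i {t} e → i < 3 ^ n → middleness n i ≡ just t → e + suc n ≡ 2 * t →
  uncurry (Side e) (pair n i)
side-pair zero    i     e _  ()
side-pair (suc n) i {t} e i< eq e≡ =
  subst (uncurry (Side e)) (sym (pair-suc n i i<)) (from-parent (middleness-suc-just n i eq))
  where
  from-parent : middleness n (i / 3) ≡ just t ⊎ (middleness n (i / 3) ≡ nothing × i % 3 ≢ 1 × t ≡ suc n) →
                uncurry (Side e) (subpair (i % 3) (pair n (i / 3)))
  from-parent (inj₁ parent) =
    side-subpair (side-pair n (i / 3) (suc e) (/3<3^ n i<) parent (trans (sym (+-suc e (suc n))) e≡)) (i % 3)
  from-parent (inj₂ (parent , last≢1 , refl)) =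
    subst₂ (λ k e → uncurry (Side e) (subpair (i % 3) (pair n k)))
           (sym (middleness-nothing n (i / 3) (/3<3^ n i<) parent)) (sym e≡n)
           (middle-subpair-side (middle-pair n) (i % 3) last≢1)
    where
    double : ∀ n → 2 * suc n ≡ n + suc (suc n)
    double = solve-∀
    e≡n : e ≡ n
    e≡n = +-cancelʳ-≡ (suc (suc n)) e n (trans e≡ (double n))

C-middle : ∀ n → C n (middleIndex n) ≡ + (3 ^ n)
C-middle n = cross-middle (middle-pair n)

m∸n∸1≡m∸1+n : ∀ m n → m ∸ n ∸ 1 ≡ m ∸ suc n
m∸n∸1≡m∸1+n m n = trans (∸-+-assoc m n 1) (cong (m ∸_) (+-comm n 1))

C-off-middle : ∀ n i {t} → i < 3 ^ n → middleness n i ≡ just t → n < 2 * t → C n i ≡ + (3 ^ (2 * t ∸ n ∸ 1))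
C-off-middle n i {t} i< eq n<2t = cross-side (side-pair n i _ i< eq exponent)
  where
  exponent : 2 * t ∸ n ∸ 1 + suc n ≡ 2 * t
  exponent = trans (cong (_+ suc n) (m∸n∸1≡m∸1+n (2 * t) n)) (m∸n+n≡m n<2t)

3^e≡1⇒e≡0 : ∀ e → + (3 ^ e) ≡ 1ℤ → e ≡ 0
3^e≡1⇒e≡0 e eq with m^n≡1⇒n≡0∨m≡1 3 e (ℤ.+-injective eq)
... | inj₁ e≡0 = e≡0
... | inj₂ ()

⌈n/2⌉<t⇒1+n<2t : ∀ n t → ⌈ n /2⌉ < t → suc n < 2 * t
⌈n/2⌉<t⇒1+n<2t n t c<t = begin-strict
  suc n                  ≡⟨ cong suc (⌊n/2⌋+⌈n/2⌉≡n n) ⟨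
  suc (⌊ n /2⌋ + c)      ≤⟨ s≤s (+-monoˡ-≤ c (⌊n/2⌋≤⌈n/2⌉ n)) ⟩
  suc (c + c)            <⟨ n<1+n _ ⟩
  suc (suc (c + c))      ≡⟨ double c ⟩
  2 * suc c              ≤⟨ *-monoʳ-≤ 2 c<t ⟩
  2 * t                  ∎
  where
  open ≤-Reasoning
  c = ⌈ n /2⌉
  double : ∀ c → suc (suc (c + c)) ≡ 2 * suc c
  double = solve-∀

C≢1-near-middle : ∀ r s j → suc (suc r + s) < 2 * suc s → j < 3 ^ (suc r + s) →
  prefix (suc r) j ≡ middleIndex s → C (suc r + s) j ≢ 1ℤ
C≢1-near-middle r s j half j< prefix≡ = C≢1 (middleness n j) refl
  where
  n = suc r + s
  C≢1 : ∀ μ → middleness n j ≡ μ → C n j ≢ 1ℤ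
  C≢1 nothing eq C≡1 with 3^e≡1⇒e≡0 n (trans (sym (C-middle n)) (subst (λ k → C n k ≡ 1ℤ) (middleness-nothing n j j< eq) C≡1))
  ... | ()
  C≢1 (just t) eq C≡1 = contradiction exponent≡0 (m<n⇒n≢0 0<exponent)
    where
    1+n<2t : suc n < 2 * t
    1+n<2t = ≤-trans half (*-monoʳ-≤ 2 (prefix⇒middleness> (suc r) s j prefix≡ eq))
    exponent≡0 : 2 * t ∸ n ∸ 1 ≡ 0
    exponent≡0 = 3^e≡1⇒e≡0 _ (trans (sym (C-off-middle n j j< eq (<-trans (n<1+n n) 1+n<2t))) C≡1)
    0<exponent : 0 < 2 * t ∸ n ∸ 1
    0<exponent = subst (0 <_) (sym (m∸n∸1≡m∸1+n (2 * t) n)) (m<n⇒0<n∸m 1+n<2t)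

in-steeple : ∀ {n} r s i → n ≡ suc r + s → suc n < 2 * suc s → i < 3 ^ n →
  prefix (suc r) i ≡ middleIndex s → InSteeple n i
in-steeple r s i refl half i< prefix≡ j lo hi = C≢1-near-middle r s j half
  (≤-<-trans hi (⊔-lub i< (middleIndex<3^ (suc r + s))))
  (prefix-between (suc r) prefix≡ (prefix-middleIndex (suc r) s) lo hi)

lemma18 : (n i : ℕ) → i < 3 ^ n →
    (i ≡ middleIndex n → C n i ≡ + (3 ^ n)) ×
    (¬ (i ≡ middleIndex n) → (t : ℕ) → middleness n i ≡ just t → ⌈ n /2⌉ < t →
    InSteeple n i × C n i ≡ + (3 ^ (2 * t ∸ n ∸ 1)))
lemma18 n i i< = at-middle , off-middle
  where
  at-middle : i ≡ middleIndex n → C n i ≡ + (3 ^ n)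
  at-middle refl = C-middle n
  off-middle : ¬ (i ≡ middleIndex n) → (t : ℕ) → middleness n i ≡ just t → ⌈ n /2⌉ < t →
    InSteeple n i × C n i ≡ + (3 ^ (2 * t ∸ n ∸ 1))
  -- i ≢ middleIndex n already follows from middleness n i ≡ just t.
  off-middle _ t eq c<t with middleness-just⇒prefix n i i< eq
  ... | r , s , n≡ , refl , prefix≡ =
    in-steeple r s i n≡ 1+n<2t i< prefix≡ , C-off-middle n i i< eq (<-trans (n<1+n n) 1+n<2t)
    where
    1+n<2t : suc n < 2 * suc s
    1+n<2t = ⌈n/2⌉<t⇒1+n<2t n (suc s) c<t
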